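{- Every variety $\mathcal{V}$ of $\tau$-expansions is generated by the class $\mathcal{V}\cap K^{*}_\tau$.
   Context: A $\tau$-expansion is a Heyting algebra $\mathfrak{A}$ with an additional constant (nullary operation) $\tau$. A $\sim$-negation on a Heyting algebra is a unary operation $\sim$ satisfying for all $x,y$: $x\rightarrow y\le\sim y\rightarrow\sim x$; $x\wedge\sim x\le\sim\mathbf{1}$; $\sim\mathbf{0}\le x\vee\sim x$; $\sim\mathbf{0}\rightarrow\sim\mathbf{1}\le\sim\mathbf{1}$. A $\tau\sim$-expansion is a $\tau$-expansion with a $\sim$-negation satisfying $\sim\mathbf{1}=\tau$. $K^{*}_\tau$ is the class of $\tau$-expansions obtained from $\tau\sim$-expansions by forgetting $\sim$. -}

module Defs where

open import Level using (Level; _⊔_; suc; 0ℓ)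
open import Data.Nat using (ℕ)
open import Data.Product using (Σ; _×_; _,_)
open import Relation.Binary.Lattice.Bundles using (HeytingAlgebra)

record TauExpansion (c ℓ₁ ℓ₂ : Level) : Set (suc (c ⊔ ℓ₁ ⊔ ℓ₂)) where
  field
    heyting : HeytingAlgebra c ℓ₁ ℓ₂
  open HeytingAlgebra heyting public
  field
    τ : Carrier

record IsTildeNegation {c ℓ₁ ℓ₂} (A : TauExpansion c ℓ₁ ℓ₂)
         (∼ : TauExpansion.Carrier A → TauExpansion.Carrier A) : Set (c ⊔ ℓ₁ ⊔ ℓ₂) where
  open TauExpansion A
  field
    contra   : ∀ x y → (x ⇨ y) ≤ (∼ y ⇨ ∼ x)
    noncontr : ∀ x → (x ∧ ∼ x) ≤ ∼ ⊤
    exclmid  : ∀ x → ∼ ⊥ ≤ (x ∨ ∼ x)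
    last     : (∼ ⊥ ⇨ ∼ ⊤) ≤ ∼ ⊤

-- A ∈ K*_τ : A is the τ-reduct of some τ∼-expansion, i.e. A admits a
-- ∼-negation with ∼ 1 = τ.
InKStar : ∀ {c ℓ₁ ℓ₂} → TauExpansion c ℓ₁ ℓ₂ → Set (c ⊔ ℓ₁ ⊔ ℓ₂)
InKStar A = Σ (Carrier → Carrier) λ ∼ → IsTildeNegation A ∼ × (∼ ⊤ ≈ τ)
  where open TauExpansion A

data Term : Set where
  var        : ℕ → Term
  _∧'_ _∨'_ _⇨'_ : Term → Term → Term
  ⊤' ⊥' τ'   : Term

Equation : Set
Equation = Term × Term

module _ {c ℓ₁ ℓ₂} (A : TauExpansion c ℓ₁ ℓ₂) where
  open TauExpansion A

  ⟦_⟧ : Term → (ℕ → Carrier) → Carrier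
  ⟦ var n ⟧ ρ = ρ n
  ⟦ s ∧' t ⟧ ρ = ⟦ s ⟧ ρ ∧ ⟦ t ⟧ ρ
  ⟦ s ∨' t ⟧ ρ = ⟦ s ⟧ ρ ∨ ⟦ t ⟧ ρ
  ⟦ s ⇨' t ⟧ ρ = ⟦ s ⟧ ρ ⇨ ⟦ t ⟧ ρ
  ⟦ ⊤' ⟧ ρ = ⊤
  ⟦ ⊥' ⟧ ρ = ⊥
  ⟦ τ' ⟧ ρ = τ

  _⊨_ : Equation → Set (c ⊔ ℓ₁)
  _⊨_ (s , t) = ∀ (ρ : ℕ → Carrier) → ⟦ s ⟧ ρ ≈ ⟦ t ⟧ ρ

  Models : ∀ {e} → (Equation → Set e) → Set (c ⊔ ℓ₁ ⊔ e)
  Models E = ∀ eq → E eq → _⊨_ eq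

InVariety : ∀ {c ℓ₁ ℓ₂ e} → (Equation → Set e) → TauExpansion c ℓ₁ ℓ₂ → Set (c ⊔ ℓ₁ ⊔ e)
InVariety E A = Models A E

-- "The variety Mod(E) is generated by the class Mod(E) ∩ K*_τ": every
-- identity valid in all members of Mod(E) ∩ K*_τ is valid in all of Mod(E),
-- i.e. Mod(E) = Mod(Id(Mod(E) ∩ K*_τ)).
GeneratedByKStar : ∀ (c ℓ₁ ℓ₂ : Level) {e} → (Equation → Set e) → Set (suc (c ⊔ ℓ₁ ⊔ ℓ₂) ⊔ e)
GeneratedByKStar c ℓ₁ ℓ₂ E =
  ∀ (eq : Equation) →
  (∀ (A : TauExpansion c ℓ₁ ℓ₂) → InVariety E A → InKStar A → _⊨_ A eq) →
  ∀ (A : TauExpansion c ℓ₁ ℓ₂) → InVariety E A → _⊨_ A eq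

-- If an element w lies above τ, satisfies (w ⇨ τ) ≤ τ and lies below every x ∨ (x ⇨ τ), then
-- x ↦ (x ⇨ τ) ∧ w is a ∼-negation with ∼ 1 = τ. Such a w need not exist in A, but it can be
-- approximated: let uₑ be the meet of x ∨ (x ⇨ τ) over the finitely many terms x of the e-th
-- stage of an enumeration. Adjoining the sequence (uₑ) to the constant sequences ρ n inside the
-- reduced power Aᴺ modulo the Fréchet filter generates an algebra of the variety that carries
-- such an element and still refutes every identity that ρ refutes in A.
module Submission where

open import Defs
open import Level using (Level; Lift; lift; lower)
open import Data.Nat using (ℕ; zero; suc)
import Data.Nat as Nat
open import Data.Nat.Properties using (≤-refl; ≤-trans; ≤⇒≤′; m≤m⊔n; m≤n⊔m)
open import Data.Product using (Σ; _×_; _,_; proj₁; swap)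
open import Data.List using (List; []; _∷_; _++_; foldr; map; cartesianProductWith)
open import Data.List.Membership.Propositional using (_∈_)
open import Data.List.Membership.Propositional.Properties
  using (∈-++⁺ˡ; ∈-++⁺ʳ; ∈-map⁺; ∈-cartesianProductWith⁺)
open import Data.List.Relation.Unary.Any using (here; there)
open import Data.List.Relation.Unary.All using (All; []; _∷_; universal)
import Data.List.Relation.Unary.All.Properties as All
import Relation.Binary.PropositionalEquality as ≡
open ≡ using (_≡_)
open import Relation.Binary.Lattice.Bundles using (HeytingAlgebra)
import Relation.Binary.Lattice.Properties.HeytingAlgebra as HeytingProperties
import Relation.Binary.Lattice.Properties.MeetSemilattice as MeetProperties
import Relation.Binary.Lattice.Properties.JoinSemilattice as JoinProperties
import Relation.Binary.Reasoning.PartialOrder as ≤-Reasoning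

module HeytingLemmas {c ℓ₁ ℓ₂} (H : HeytingAlgebra c ℓ₁ ℓ₂) where
  open HeytingAlgebra H
  open HeytingProperties H public
  open MeetProperties meetSemilattice public using (∧-monotonic)
  open JoinProperties joinSemilattice public using (∨-monotonic)

  ⇨-trans : ∀ {x y z} → (x ⇨ y) ∧ (y ⇨ z) ≤ x ⇨ z
  ⇨-trans = transpose-⇨ (trans (∧-greatest (trans (x∧y≤x _ _) (x∧y≤y _ _))
                                            (trans (∧-monotonic (x∧y≤x _ _) refl) ⇨-eval))
                               ⇨-eval)

  ⊥⇨-maximum : ∀ {x y} → y ≤ ⊥ ⇨ x
  ⊥⇨-maximum = transpose-⇨ (trans (x∧y≤y _ _) (minimum _))

  -- The ⇨ clause of the fact that x ↦ w ∧ x is a Heyting morphism onto the interval [⊥, w].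
  ⇨-relax-below : ∀ {w a b a′ b′} → w ∧ a′ ≤ a → w ∧ b ≤ b′ → w ∧ (a ⇨ b) ≤ a′ ⇨ b′
  ⇨-relax-below {w} {a} {b} {a′} a′≤a b≤b′ = transpose-⇨ (trans (∧-greatest below-w below-b) b≤b′)
    where
      below-w : (w ∧ (a ⇨ b)) ∧ a′ ≤ w
      below-w = trans (x∧y≤x _ _) (x∧y≤x _ _)
      below-a : (w ∧ (a ⇨ b)) ∧ a′ ≤ a
      below-a = trans (∧-greatest below-w (x∧y≤y _ _)) a′≤a
      below-b : (w ∧ (a ⇨ b)) ∧ a′ ≤ b
      below-b = trans (∧-greatest (trans (x∧y≤x _ _) (x∧y≤y _ _)) below-a) ⇨-eval

  Dense : Carrier → Carrier → Set ℓ₂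
  Dense t a = a ⇨ t ≤ t

  module _ {t : Carrier} where

    ⊤-dense : Dense t ⊤
    ⊤-dense = trans (∧-greatest refl (maximum _)) ⇨-eval

    ∧-dense : ∀ {a b} → Dense t a → Dense t b → Dense t (a ∧ b)
    ∧-dense {a} {b} a-dense b-dense = begin
      a ∧ b ⇨ t    ≈⟨ ⇨-curry ⟩
      a ⇨ (b ⇨ t)  ≤⟨ ⇨ʳ-covariant b-dense ⟩
      a ⇨ t        ≤⟨ a-dense ⟩
      t            ∎
      where open ≤-Reasoning poset

    excludedMiddle-dense : ∀ x → Dense t (x ∨ (x ⇨ t))
    excludedMiddle-dense x = trans (⇨-distribˡ-∨-∧-≤ _ _ _) (⇨-applyʳ refl)

    ≤-excludedMiddle : ∀ x → t ≤ x ∨ (x ⇨ t)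
    ≤-excludedMiddle x = trans y≤x⇨y (y≤x∨y _ _)

  ⋀ : List Carrier → Carrier
  ⋀ = foldr _∧_ ⊤

  ⋀-lowerBound : ∀ {x xs} → x ∈ xs → ⋀ xs ≤ x
  ⋀-lowerBound (here ≡.refl) = x∧y≤x _ _
  ⋀-lowerBound (there x∈xs) = trans (x∧y≤y _ _) (⋀-lowerBound x∈xs)

  ⋀-greatest : ∀ {y xs} → All (y ≤_) xs → y ≤ ⋀ xs
  ⋀-greatest [] = maximum _
  ⋀-greatest (y≤x ∷ y≤xs) = ∧-greatest y≤x (⋀-greatest y≤xs)

  ⋀-dense : ∀ {t xs} → All (Dense t) xs → Dense t (⋀ xs)
  ⋀-dense [] = ⊤-dense
  ⋀-dense (x-dense ∷ xs-dense) = ∧-dense x-dense (⋀-dense xs-dense)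

module _ {c ℓ₁ ℓ₂} (A : TauExpansion c ℓ₁ ℓ₂) where
  open TauExpansion A
  open HeytingLemmas heyting

  dense⇒InKStar : ∀ w → τ ≤ w → Dense τ w → (∀ x → w ≤ x ∨ (x ⇨ τ)) → InKStar A
  dense⇒InKStar w τ≤w w-dense w≤excludedMiddle = ∼ , isTildeNegation , ∼⊤≈τ
    where
      open ≤-Reasoning poset

      ∼ : Carrier → Carrier
      ∼ x = (x ⇨ τ) ∧ w

      ∼⊤≈τ : ∼ ⊤ ≈ τ
      ∼⊤≈τ = antisym (trans (x∧y≤x _ _) ⊤-dense) (∧-greatest y≤x⇨y τ≤w)

      w≤∼⊥ : w ≤ ∼ ⊥
      w≤∼⊥ = ∧-greatest ⊥⇨-maximum refl

      isTildeNegation : IsTildeNegation A ∼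
      isTildeNegation = record
        { contra = λ x y → transpose-⇨ (∧-greatest
            (trans (∧-monotonic refl (x∧y≤x _ _)) ⇨-trans)
            (trans (x∧y≤y _ _) (x∧y≤y _ _)))
        ; noncontr = λ x → begin
            x ∧ ((x ⇨ τ) ∧ w)  ≤⟨ ∧-monotonic refl (x∧y≤x _ _) ⟩
            x ∧ (x ⇨ τ)        ≤⟨ ⇨-applyʳ refl ⟩
            τ                  ≈⟨ Eq.sym ∼⊤≈τ ⟩
            ∼ ⊤                ∎
        ; exclmid = λ x → begin
            ∼ ⊥                      ≤⟨ x∧y≤y _ _ ⟩
            w                        ≤⟨ ∧-greatest refl (w≤excludedMiddle x) ⟩
            w ∧ (x ∨ (x ⇨ τ))        ≤⟨ ∧-distribˡ-∨-≤ _ _ _ ⟩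
            w ∧ x ∨ w ∧ (x ⇨ τ)      ≤⟨ ∨-monotonic (x∧y≤y _ _) (∧-greatest (x∧y≤y _ _) (x∧y≤x _ _)) ⟩
            x ∨ ∼ x                  ∎
        ; last = begin
            ∼ ⊥ ⇨ ∼ ⊤  ≤⟨ ⇨-relax w≤∼⊥ (reflexive ∼⊤≈τ) ⟩
            w ⇨ τ      ≤⟨ w-dense ⟩
            τ          ≈⟨ Eq.sym ∼⊤≈τ ⟩
            ∼ ⊤        ∎
        }

  AgreeBelow : Carrier → (ℕ → Carrier) → (ℕ → Carrier) → Set ℓ₂
  AgreeBelow w ρ₁ ρ₂ = ∀ n → (w ∧ ρ₁ n ≤ ρ₂ n) × (w ∧ ρ₂ n ≤ ρ₁ n)

  ⟦⟧-agreeBelow : ∀ {w ρ₁ ρ₂} → AgreeBelow w ρ₁ ρ₂ → ∀ t → w ∧ ⟦ A ⟧ t ρ₁ ≤ ⟦ A ⟧ t ρ₂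
  ⟦⟧-agreeBelow agree (var n) = proj₁ (agree n)
  ⟦⟧-agreeBelow agree (s ∧' t) = ∧-greatest
    (trans (∧-monotonic refl (x∧y≤x _ _)) (⟦⟧-agreeBelow agree s))
    (trans (∧-monotonic refl (x∧y≤y _ _)) (⟦⟧-agreeBelow agree t))
  ⟦⟧-agreeBelow agree (s ∨' t) =
    trans (∧-distribˡ-∨-≤ _ _ _) (∨-monotonic (⟦⟧-agreeBelow agree s) (⟦⟧-agreeBelow agree t))
  ⟦⟧-agreeBelow agree (s ⇨' t) =
    ⇨-relax-below (⟦⟧-agreeBelow (λ n → swap (agree n)) s) (⟦⟧-agreeBelow agree t)
  ⟦⟧-agreeBelow agree ⊤' = x∧y≤y _ _
  ⟦⟧-agreeBelow agree ⊥' = x∧y≤y _ _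
  ⟦⟧-agreeBelow agree τ' = x∧y≤y _ _

Eventually : ∀ {ℓ} → (ℕ → Set ℓ) → Set ℓ
Eventually P = Σ ℕ λ d → ∀ {e} → d Nat.≤ e → P e

always : ∀ {ℓ} {P : ℕ → Set ℓ} → (∀ e → P e) → Eventually P
always p = 0 , λ {e} _ → p e

Eventually-map : ∀ {ℓ ℓ′} {P : ℕ → Set ℓ} {Q : ℕ → Set ℓ′} →
                 (∀ {e} → P e → Q e) → Eventually P → Eventually Q
Eventually-map f (d , p) = d , λ d≤e → f (p d≤e)

Eventually-zipWith : ∀ {ℓ ℓ′ ℓ″} {P : ℕ → Set ℓ} {Q : ℕ → Set ℓ′} {R : ℕ → Set ℓ″} →
                     (∀ {e} → P e → Q e → R e) → Eventually P → Eventually Q → Eventually R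
Eventually-zipWith f (d₁ , p) (d₂ , q) = d₁ Nat.⊔ d₂ , λ d≤e →
  f (p (≤-trans (m≤m⊔n d₁ d₂) d≤e)) (q (≤-trans (m≤n⊔m d₁ d₂) d≤e))

squares : (Term → Term → Term) → List Term → List Term
squares _∙_ S = cartesianProductWith _∙_ S S

stage : ℕ → List Term
stage zero = ⊤' ∷ ⊥' ∷ τ' ∷ []
stage (suc e) = var e ∷ (S ++ squares _∧'_ S ++ squares _∨'_ S ++ squares _⇨'_ S)
  where S = stage e

∈-stage-suc : ∀ {s e} → s ∈ stage e → s ∈ stage (suc e)
∈-stage-suc s∈S = there (∈-++⁺ˡ s∈S)

∈-stage-mono : ∀ {s e e′} → e Nat.≤ e′ → s ∈ stage e → s ∈ stage e′
∈-stage-mono e≤e′ = go (≤⇒≤′ e≤e′)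
  where
    go : ∀ {s e e′} → e Nat.≤′ e′ → s ∈ stage e → s ∈ stage e′
    go Nat.≤′-refl s∈S = s∈S
    go (Nat.≤′-step e≤′e′) s∈S = ∈-stage-suc (go e≤′e′ s∈S)

∧'-∈-stage : ∀ {s t e} → s ∈ stage e → t ∈ stage e → s ∧' t ∈ stage (suc e)
∧'-∈-stage {e = e} s∈S t∈S =
  there (∈-++⁺ʳ (stage e) (∈-++⁺ˡ (∈-cartesianProductWith⁺ _∧'_ s∈S t∈S)))

∨'-∈-stage : ∀ {s t e} → s ∈ stage e → t ∈ stage e → s ∨' t ∈ stage (suc e)
∨'-∈-stage {e = e} s∈S t∈S = there (∈-++⁺ʳ (stage e) (∈-++⁺ʳ (squares _∧'_ (stage e))
  (∈-++⁺ˡ (∈-cartesianProductWith⁺ _∨'_ s∈S t∈S))))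

⇨'-∈-stage : ∀ {s t e} → s ∈ stage e → t ∈ stage e → s ⇨' t ∈ stage (suc e)
⇨'-∈-stage {e = e} s∈S t∈S = there (∈-++⁺ʳ (stage e) (∈-++⁺ʳ (squares _∧'_ (stage e))
  (∈-++⁺ʳ (squares _∨'_ (stage e)) (∈-cartesianProductWith⁺ _⇨'_ s∈S t∈S))))

∈-stage-binary : ∀ {s t u} → (∀ {e} → s ∈ stage e → t ∈ stage e → u ∈ stage (suc e)) →
                 Σ ℕ (λ e → s ∈ stage e) → Σ ℕ (λ e → t ∈ stage e) → Σ ℕ (λ e → u ∈ stage e)
∈-stage-binary combine (d₁ , s∈S) (d₂ , t∈S) = suc (d₁ Nat.⊔ d₂) ,
  combine (∈-stage-mono (m≤m⊔n d₁ d₂) s∈S) (∈-stage-mono (m≤n⊔m d₁ d₂) t∈S)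

∈-stage : ∀ s → Σ ℕ λ e → s ∈ stage e
∈-stage (var n) = suc n , here ≡.refl
∈-stage (s ∧' t) = ∈-stage-binary ∧'-∈-stage (∈-stage s) (∈-stage t)
∈-stage (s ∨' t) = ∈-stage-binary ∨'-∈-stage (∈-stage s) (∈-stage t)
∈-stage (s ⇨' t) = ∈-stage-binary ⇨'-∈-stage (∈-stage s) (∈-stage t)
∈-stage ⊤' = 0 , here ≡.refl
∈-stage ⊥' = 0 , there (here ≡.refl)
∈-stage τ' = 0 , there (there (here ≡.refl))

∈-stage-eventually : ∀ s → Eventually (λ e → s ∈ stage e)
∈-stage-eventually s with ∈-stage s
... | d , s∈S = d , λ d≤e → ∈-stage-mono d≤e s∈S

-- The subalgebra of the reduced power Aᴺ (modulo the Fréchet filter) generated by the sequences (ρs e n)ₑ, presented by terms.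
module EventualTermAlgebra {c ℓ₁ ℓ₂} (A : TauExpansion c ℓ₁ ℓ₂) (ρs : ℕ → ℕ → TauExpansion.Carrier A) where
  open TauExpansion A

  at : ℕ → Lift c Term → Carrier
  at e t = ⟦ A ⟧ (lower t) (ρs e)

  heytingAlgebra : HeytingAlgebra c ℓ₁ ℓ₂
  heytingAlgebra = record
    { Carrier = Lift c Term
    ; _≈_ = λ s t → Eventually (λ e → at e s ≈ at e t)
    ; _≤_ = λ s t → Eventually (λ e → at e s ≤ at e t)
    ; _∨_ = λ s t → lift (lower s ∨' lower t)
    ; _∧_ = λ s t → lift (lower s ∧' lower t)
    ; _⇨_ = λ s t → lift (lower s ⇨' lower t)
    ; ⊤ = lift ⊤'
    ; ⊥ = lift ⊥'
    ; isHeytingAlgebra = record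
      { isBoundedLattice = record
        { isLattice = record
          { isPartialOrder = record
            { isPreorder = record
              { isEquivalence = record
                { refl = always λ _ → Eq.refl
                ; sym = Eventually-map Eq.sym
                ; trans = Eventually-zipWith Eq.trans
                }
              ; reflexive = Eventually-map reflexive
              ; trans = Eventually-zipWith trans
              }
            ; antisym = Eventually-zipWith antisym
            }
          ; supremum = λ s t → always (λ _ → x≤x∨y _ _) , always (λ _ → y≤x∨y _ _) ,
                               λ _ → Eventually-zipWith ∨-least
          ; infimum = λ s t → always (λ _ → x∧y≤x _ _) , always (λ _ → x∧y≤y _ _) ,
                              λ _ → Eventually-zipWith ∧-greatest
          }
        ; maximum = λ _ → always λ _ → maximum _
        ; minimum = λ _ → always λ _ → minimum _
        }
      ; exponential = λ _ _ _ → Eventually-map transpose-⇨ , Eventually-map transpose-∧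
      }
    }

  termAlgebra : TauExpansion c ℓ₁ ℓ₂
  termAlgebra = record { heyting = heytingAlgebra ; τ = lift τ' }

  at-⟦⟧ : ∀ e s σ → at e (⟦ termAlgebra ⟧ s σ) ≡ ⟦ A ⟧ s (λ n → at e (σ n))
  at-⟦⟧ e (var n) σ = ≡.refl
  at-⟦⟧ e (s ∧' t) σ = ≡.cong₂ _∧_ (at-⟦⟧ e s σ) (at-⟦⟧ e t σ)
  at-⟦⟧ e (s ∨' t) σ = ≡.cong₂ _∨_ (at-⟦⟧ e s σ) (at-⟦⟧ e t σ)
  at-⟦⟧ e (s ⇨' t) σ = ≡.cong₂ _⇨_ (at-⟦⟧ e s σ) (at-⟦⟧ e t σ)
  at-⟦⟧ e ⊤' σ = ≡.refl
  at-⟦⟧ e ⊥' σ = ≡.refl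
  at-⟦⟧ e τ' σ = ≡.refl

  InVariety-termAlgebra : ∀ {ℓ} (E : Equation → Set ℓ) → InVariety E A → InVariety E termAlgebra
  InVariety-termAlgebra E A∈V (s , t) s≈t∈E σ = always λ e →
    ≡.subst₂ _≈_ (≡.sym (at-⟦⟧ e s σ)) (≡.sym (at-⟦⟧ e t σ)) (A∈V (s , t) s≈t∈E (λ n → at e (σ n)))

-- Variable 0 names the element on which the ∼-negation is built; the given valuation is shifted to the variables ≥ 1.
module Witness {c ℓ₁ ℓ₂} (A : TauExpansion c ℓ₁ ℓ₂) (ρ : ℕ → TauExpansion.Carrier A) where
  open TauExpansion A
  open HeytingLemmas heyting

  extend : Carrier → ℕ → Carrier
  extend w zero = w
  extend w (suc n) = ρ n

  excludedMiddle : Term → Term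
  excludedMiddle x = x ∨' (x ⇨' τ')

  -- Evaluating at 0 ↦ ⊤ rather than 0 ↦ u e keeps the definition non-circular; ⟦⟧-agreeBelow bridges the two.
  u : ℕ → Carrier
  u e = ⋀ (map (λ x → ⟦ A ⟧ (excludedMiddle x) (extend ⊤)) (stage e))

  τ≤u : ∀ e → τ ≤ u e
  τ≤u e = ⋀-greatest (All.map⁺ (universal (λ x → ≤-excludedMiddle (⟦ A ⟧ x (extend ⊤))) (stage e)))

  u-dense : ∀ e → Dense τ (u e)
  u-dense e = ⋀-dense (All.map⁺ (universal (λ x → excludedMiddle-dense (⟦ A ⟧ x (extend ⊤))) (stage e)))

  agreeBelow-extend : ∀ w → AgreeBelow A w (extend ⊤) (extend w)
  agreeBelow-extend w zero = x∧y≤x _ _ , maximum _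
  agreeBelow-extend w (suc n) = x∧y≤y _ _ , x∧y≤y _ _

  u≤excludedMiddle : ∀ {x e} → x ∈ stage e → u e ≤ ⟦ A ⟧ (excludedMiddle x) (extend (u e))
  u≤excludedMiddle {x} {e} x∈S = begin
    u e                                            ≤⟨ ∧-greatest refl (⋀-lowerBound (∈-map⁺ _ x∈S)) ⟩
    u e ∧ ⟦ A ⟧ (excludedMiddle x) (extend ⊤)     ≤⟨ ⟦⟧-agreeBelow A (agreeBelow-extend (u e)) (excludedMiddle x) ⟩
    ⟦ A ⟧ (excludedMiddle x) (extend (u e))       ∎
    where open ≤-Reasoning poset

  open EventualTermAlgebra A (λ e → extend (u e)) public

  termAlgebra-InKStar : InKStar termAlgebra
  termAlgebra-InKStar = dense⇒InKStar termAlgebra (lift (var 0)) (always τ≤u) (always u-dense)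
    λ x → Eventually-map u≤excludedMiddle (∈-stage-eventually (lower x))

  termAlgebra-reflects : ∀ s t → _⊨_ termAlgebra (s , t) → ⟦ A ⟧ s ρ ≈ ⟦ A ⟧ t ρ
  termAlgebra-reflects s t s≈t = reflect (s≈t shifted)
    where
      shifted : ℕ → Lift c Term
      shifted n = lift (var (suc n))
      reflect : Eventually (λ e → at e (⟦ termAlgebra ⟧ s shifted) ≈ at e (⟦ termAlgebra ⟧ t shifted)) →
                ⟦ A ⟧ s ρ ≈ ⟦ A ⟧ t ρ
      reflect (d , s≈t-from-d) = ≡.subst₂ _≈_ (at-⟦⟧ d s shifted) (at-⟦⟧ d t shifted) (s≈t-from-d ≤-refl)

propositionP : ∀ (c ℓ₁ ℓ₂ e : Level) (E : Equation → Set e) → GeneratedByKStar c ℓ₁ ℓ₂ E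
propositionP c ℓ₁ ℓ₂ e E (s , t) holdsInKStar A A∈V ρ =
  termAlgebra-reflects s t (holdsInKStar termAlgebra (InVariety-termAlgebra E A∈V) termAlgebra-InKStar)
  where open Witness A ρ
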